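{- For every $n>0$ and every weak composition $\mathbf w$ of $m$ with $r$ parts, the map $\sigma\mapsto f_{\mathbf w}\circ\sigma$ restricts to a bijection from the set of $\sigma\in\widetilde S_m$ that are minimal-length right $S_{\mathbf w}$-coset representatives and satisfy $\sigma(x)<\sigma(x+n)$ for all $x\in\mathbb Z$, onto the set of $n$-stable $(m,r)$-affine compositions of weight $\mathbf w$.
   Context: $m,r$ are positive integers and $\mathbf w=(w_1,\dots,w_r)\in\mathbb Z^r_{\ge0}$ with $\sum w_i=m$. $\widetilde S_m$ is the group of bijections $\sigma:\mathbb Z\to\mathbb Z$ with $\sigma(x+m)=\sigma(x)+m$ and $\sum_{i=1}^m\sigma(i)=m(m+1)/2$. An $(m,r)$-affine composition is $f:\mathbb Z\to\mathbb Z$ with $f(x+m)=f(x)+r$, such that $f^{ -1}([1,r])$ has exactly $m$ elements, pairwise distinct mod $m$, with sum $m(m+1)/2$; its weight is $(|f^{ -1}(1)|,\dots,|f^{ -1}(r)|)$; it is $n$-stable if $f(x+n)\ge f(x)$ for all $x$. $f_{\mathbf w}$ is the affine composition with $f_{\mathbf w}(x)=i$ for $w_1+\dots+w_{i-1}<x\le w_1+\dots+w_i$ ($1\le i\le r$), extended by $f_{\mathbf w}(x+m)=f_{\mathbf w}(x)+r$. $\sigma\in\widetilde S_m$ is a minimal-length right coset representative for $S_{\mathbf w}=S_{w_1}\times\dots\times S_{w_r}$ if $\sigma^{ -1}(w_1+\dots+w_{i-1}+1)<\dots<\sigma^{ -1}(w_1+\dots+w_i)$ for every $i=1,\dots,r$.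 -}

module Defs where

open import Data.Nat as ℕ using (ℕ; zero; suc; NonZero)
open import Data.Integer as ℤ using (ℤ; +_; _+_; _*_; _<_; _≤_)
open import Data.Integer.DivMod using (_/ℕ_; _%ℕ_)
open import Data.Bool using (true; false)
open import Data.Fin using (Fin; toℕ)
open import Data.Nat.ListAction using () renaming (sum to sumℕ)
open import Data.Vec as Vec using (Vec; []; _∷_)
open import Data.List as List using (List; length)
open import Data.List.Membership.Propositional using (_∈_)
open import Data.List.Relation.Unary.AllPairs using (AllPairs)
open import Data.List.Relation.Unary.Unique.Propositional using (Unique)
open import Data.Product using (Σ; ∃; _×_; _,_)
open import Function.Bundles using (_⇔_)
open import Relation.Binary.PropositionalEquality using (_≡_; _≢_)
open import Relation.Nullary using (¬_)

ι : ℕ → ℤ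
ι n = + n

sumTo : (ℤ → ℤ) → ℕ → ℤ
sumTo σ zero    = + 0
sumTo σ (suc k) = sumTo σ k + σ (+ suc k)

tri : ℕ → ℤ
tri m = + ((m ℕ.* suc m) ℕ./ 2)

record IsAffinePerm (m : ℕ) (σ : ℤ → ℤ) : Set where
  field
    injective  : ∀ x y → σ x ≡ σ y → x ≡ y
    surjective : ∀ y → ∃ λ x → σ x ≡ y
    periodic   : ∀ x → σ (x + ι m) ≡ σ x + ι m
    window-sum : sumTo σ m ≡ tri m

record IsAffineComposition (m r : ℕ) .{{_ : NonZero m}} (f : ℤ → ℤ) : Set where
  field
    periodic : ∀ x → f (x + ι m) ≡ f x + ι r
    window          : List ℤ
    window-complete : ∀ x → (x ∈ window) ⇔ ((+ 1 ≤ f x) × (f x ≤ ι r))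
    window-unique   : Unique window
    window-size     : length window ≡ m
    window-distinct-mod : AllPairs (λ a b → a %ℕ m ≢ b %ℕ m) window
    window-sum      : List.foldr _+_ (+ 0) window ≡ tri m

FibreSize : (ℤ → ℤ) → ℤ → ℕ → Set
FibreSize f i k = Σ (List ℤ) λ L →
  ((∀ x → (x ∈ L) ⇔ (f x ≡ i)) × Unique L × (length L ≡ k))

HasWeight : ∀ {r} → (ℤ → ℤ) → Vec ℕ r → Set
HasWeight {r} f w = ∀ (i : Fin r) → FibreSize f (+ suc (toℕ i)) (Vec.lookup w i)

IsStable : ℕ → (ℤ → ℤ) → Set
IsStable n f = ∀ x → f x ≤ f (x + ι n)

prefix : ∀ {r} → Vec ℕ r → ℕ → ℕ
prefix w k = sumℕ (List.take k (Vec.toList w))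

-- index of the block of w containing t+1, for 0 ≤ t < w₁+…+w_r
-- (the i with w₁+…+w_{i-1} ≤ t < w₁+…+w_i)
block : ∀ {r} → Vec ℕ r → ℕ → ℕ
block []       t = 1
block (a ∷ ws) t with t ℕ.<ᵇ a
... | true  = 1
... | false = suc (block ws (t ℕ.∸ a))

-- f_w : f_w(x) = i for w₁+…+w_{i-1} < x ≤ w₁+…+w_i (1 ≤ i ≤ r),
-- extended by f_w(x + m) = f_w(x) + r.  Writing x - 1 = q m + t with
-- 0 ≤ t < m gives f_w(x) = q r + block w t.
fw : (m : ℕ) .{{_ : NonZero m}} → ∀ {r} → Vec ℕ r → ℤ → ℤ
fw m {r} w x = ((x ℤ.- + 1) /ℕ m) * ι r + ι (block w ((x ℤ.- + 1) %ℕ m))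

-- σ is a minimal-length right coset representative for S_w:
-- σ⁻¹(w₁+…+w_{i-1}+1) < … < σ⁻¹(w₁+…+w_i) for every i = 1,…,r
-- (σ⁻¹(a) written as "the x with σ x = a").
IsMinCosetRep : ∀ {r} → Vec ℕ r → (ℤ → ℤ) → Set
IsMinCosetRep {r} w σ =
  ∀ (i a : ℕ) → 1 ℕ.≤ i → i ℕ.≤ r →
  suc (prefix w (i ℕ.∸ 1)) ℕ.≤ a → suc a ℕ.≤ prefix w i →
  ∀ x y → σ x ≡ ι a → σ y ≡ ι (suc a) → x < y

InDomain : (m n : ℕ) → ∀ {r} → Vec ℕ r → (ℤ → ℤ) → Set
InDomain m n w σ = IsAffinePerm m σ × IsMinCosetRep w σ × (∀ x → σ x < σ (x + ι n))

InTarget : (m r n : ℕ) .{{_ : NonZero m}} → Vec ℕ r → (ℤ → ℤ) → Set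
InTarget m r n w f = IsAffineComposition m r f × HasWeight f w × IsStable n f

{-# OPTIONS --safe #-}
module Submission where

-- f_w is a non-decreasing staircase with f_w (x + m) = f_w x + r which, on the window
-- 1, …, m, takes the value i exactly on the i-th block of w.  So f_w ∘ σ is periodic, its
-- window is σ⁻¹ [1, m], its fibres are the σ-preimages of blocks, and σ (x) < σ (x + n)
-- makes it n-stable.  The coset condition says σ⁻¹ is increasing along each fibre of f_w;
-- as these fibres are finite intervals, f_w ∘ σ determines σ.  Conversely, f determines σ
-- by sending the points of f⁻¹ (i + q r) in increasing order onto the i-th block of the
-- q-th period.  Window sums are compared through Σ_{t<m} (σ t - t), which is the same
-- over every complete residue system mod m.

open import Defs
open import Data.Nat using (ℕ; NonZero; _≤_)
open import Data.Nat.ListAction using (sum)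
open import Data.Integer using (ℤ)
open import Data.Vec using (Vec; toList)
open import Data.Product using (∃; _×_)
open import Function using (_∘_)
open import Relation.Binary.PropositionalEquality using (_≡_)

open import Algebra.Bundles using (AbelianGroup)
open import Data.Bool using (true; false; T)
open import Data.Empty using (⊥; ⊥-elim)
open import Data.Fin as Fin using (Fin; toℕ)
import Data.Fin.Properties as FinP
open import Data.Integer as ℤ using (+_; -[1+_]; _+_; _*_; _-_; -_; +≤+; +<+; ∣_∣)
open import Data.Integer.DivMod using (_/ℕ_; _%ℕ_; a≡a%ℕn+[a/ℕn]*n; n%ℕd<d)
import Data.Integer.Properties as ℤP
open import Data.Integer.Tactic.RingSolver using (solve-∀)
open import Data.List as List using (List; []; _∷_; length)
open import Data.Vec as Vec using ([]; _∷_)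
open import Data.List.Membership.Propositional using (_∈_; _∉_)
import Data.List.Membership.Propositional.Properties as ∈P
import Data.List.Properties as ListP
open import Data.List.Relation.Unary.All as All using (All; []; _∷_)
import Data.List.Relation.Unary.All.Properties as AllP
open import Data.List.Relation.Unary.AllPairs using (AllPairs; []; _∷_)
import Data.List.Relation.Unary.AllPairs.Properties as AllPairsP
open import Data.List.Relation.Unary.Any using (here; there)
open import Data.List.Relation.Unary.Unique.Propositional using (Unique)
import Data.List.Relation.Unary.Unique.Propositional.Properties as UniqueP
open import Data.Nat as ℕ using (zero; suc; z≤n; s≤s)
import Data.Nat.DivMod as ℕDiv
import Data.Nat.Properties as ℕP
open import Data.List.Membership.DecPropositional ℕP._≟_ using (_∈?_)
import Data.Nat.Tactic.RingSolver as ℕSolver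
open import Data.Product using (_,_; proj₁; proj₂)
open import Data.Unit using (tt)
open import Function using (id; _⇔_; mk⇔; Equivalence)
open import Relation.Binary using (tri<; tri≈; tri>)
open import Relation.Binary.PropositionalEquality
  using (refl; sym; trans; cong; cong₂; subst; subst₂; _≢_; module ≡-Reasoning)
open import Relation.Nullary using (¬_; yes; no)

open import Algebra.Properties.Group (AbelianGroup.group ℤP.+-0-abelianGroup) using (quasigroup)
open import Algebra.Properties.Quasigroup quasigroup using ()
  renaming (cancelˡ to +-cancelˡ; cancelʳ to +-cancelʳ)

i≤j⇒∃[k]j≡i+k : ∀ {i j} → i ℤ.≤ j → ∃ λ k → j ≡ i + + k
i≤j⇒∃[k]j≡i+k {i} {j} i≤j =
  ∣ j - i ∣ , trans (j≡i+[j-i] i j) (cong (_+_ i) (sym (ℤP.0≤i⇒+∣i∣≡i (ℤP.i≤j⇒0≤j-i i≤j))))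
  where
  j≡i+[j-i] : ∀ i j → j ≡ i + (j - i)
  j≡i+[j-i] = solve-∀

i<j⇒∃[k]j≡i+1+k : ∀ {i j} → i ℤ.< j → ∃ λ k → j ≡ i + + suc k
i<j⇒∃[k]j≡i+1+k {i} i<j with k , refl ← i≤j⇒∃[k]j≡i+k (ℤP.i<j⇒suc[i]≤j i<j) = k , regroup i (+ k)
  where
  regroup : ∀ i k → (+ 1 + i) + k ≡ i + (+ 1 + k)
  regroup = solve-∀

i<j+1+k⇒i≤j+k : ∀ {i} j k → i ℤ.< j + + suc k → i ℤ.≤ j + + k
i<j+1+k⇒i≤j+k j k i< = subst (_ ℤ.≤_) (pred-regroup j (+ k)) (ℤP.i<j⇒i≤pred[j] i<)
  where
  pred-regroup : ∀ j k → - + 1 + (j + (+ 1 + k)) ≡ j + k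
  pred-regroup = solve-∀

+-cancelʳ-< : ∀ {i j} k → i + k ℤ.< j + k → i ℤ.< j
+-cancelʳ-< k i+k<j+k = ℤP.≰⇒> (λ j≤i → ℤP.<⇒≱ i+k<j+k (ℤP.+-monoˡ-≤ k j≤i))

representation-unique : ∀ {m t t′} q q′ → t ℕ.< m → t′ ℕ.< m →
  + t + q * + m ≡ + t′ + q′ * + m → q ≡ q′ × t ≡ t′
representation-unique {m} {t} {t′} q q′ t<m t′<m eq = q≡q′ , remainders
  where
  regroup : ∀ t q k M → t + (q + k) * M ≡ (t + k * M) + q * M
  regroup = solve-∀

  no-jump : ∀ {s s′} p k → s ℕ.< m → + s + p * + m ≢ + s′ + (p + + suc k) * + m
  no-jump {s} {s′} p k s<m e = ℕP.<-irrefl refl (ℕP.<-≤-trans s<m m≤s)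
    where
    s≡ : + s ≡ + (s′ ℕ.+ suc k ℕ.* m)
    s≡ = trans (+-cancelʳ (p * + m) _ _ (trans e (regroup (+ s′) p (+ suc k) (+ m))))
               (trans (cong (_+_ (+ s′)) (sym (ℤP.pos-* (suc k) m))) (sym (ℤP.pos-+ s′ _)))
    m≤s : m ℕ.≤ s
    m≤s = ℕP.≤-trans (ℕP.m≤m+n m _) (ℕP.≤-trans (ℕP.m≤n+m _ s′) (ℕP.≤-reflexive (sym (ℤP.+-injective s≡))))

  q≡q′ : q ≡ q′
  q≡q′ with ℤP.<-cmp q q′
  ... | tri≈ _ q≡ _ = q≡
  ... | tri< q<q′ _ _ with k , refl ← i<j⇒∃[k]j≡i+1+k q<q′ = ⊥-elim (no-jump q k t<m eq)
  ... | tri> _ _ q′<q with k , refl ← i<j⇒∃[k]j≡i+1+k q′<q = ⊥-elim (no-jump q′ k t′<m (sym eq))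

  remainders : t ≡ t′
  remainders = ℤP.+-injective (+-cancelʳ (q′ * + m) _ _ (subst (λ p → + t + p * + m ≡ _) q≡q′ eq))

divMod-unique : ∀ m .{{_ : NonZero m}} {a t} q → t ℕ.< m → a ≡ + t + q * + m →
  a /ℕ m ≡ q × a %ℕ m ≡ t
divMod-unique m {a} q t<m a≡ =
  representation-unique (a /ℕ m) q (n%ℕd<d a m) t<m (trans (sym (a≡a%ℕn+[a/ℕn]*n a m)) a≡)

shift-multiple : (g : ℤ → ℤ) {A B : ℤ} → (∀ x → g (x + A) ≡ g x + B) →
  ∀ x k → g (x + k * A) ≡ g x + k * B
shift-multiple g {A} {B} step x (+ n) = shift-ℕ x n
  where
  open ≡-Reasoning
  zero-shift : ∀ x A → x + + 0 * A ≡ x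
  zero-shift = solve-∀
  one-more : ∀ x n A → x + (+ 1 + n) * A ≡ (x + n * A) + A
  one-more = solve-∀

  shift-ℕ : ∀ x n → g (x + + n * A) ≡ g x + + n * B
  shift-ℕ x zero = trans (cong g (zero-shift x A)) (sym (zero-shift (g x) B))
  shift-ℕ x (suc n) = begin
    g (x + (+ 1 + + n) * A)   ≡⟨ cong g (one-more x (+ n) A) ⟩
    g ((x + + n * A) + A)     ≡⟨ step _ ⟩
    g (x + + n * A) + B       ≡⟨ cong (_+ B) (shift-ℕ x n) ⟩
    (g x + + n * B) + B       ≡⟨ sym (one-more (g x) (+ n) B) ⟩
    g x + (+ 1 + + n) * B     ∎
shift-multiple g {A} {B} step x -[1+ k ] = begin
  g (x + - K * A)                     ≡⟨ add-sub (g (x + - K * A)) (K * B) ⟩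
  (g (x + - K * A) + K * B) - K * B   ≡⟨ cong (_- K * B) (sym (shift-multiple g step (x + - K * A) K)) ⟩
  g ((x + - K * A) + K * A) - K * B   ≡⟨ cong (λ y → g y - K * B) (cancel x K A) ⟩
  g x - K * B                         ≡⟨ sub-neg (g x) K B ⟩
  g x + - K * B                       ∎
  where
  open ≡-Reasoning
  K : ℤ
  K = + suc k
  add-sub : ∀ a b → a ≡ (a + b) - b
  add-sub = solve-∀
  cancel : ∀ x K A → (x + - K * A) + K * A ≡ x
  cancel = solve-∀
  sub-neg : ∀ a K B → a - K * B ≡ a + - K * B
  sub-neg = solve-∀

-- Blocks of a weak composition

<ᵇ≡true⇒< : ∀ {t a} → (t ℕ.<ᵇ a) ≡ true → t ℕ.< a
<ᵇ≡true⇒< {t} {a} e = ℕP.<ᵇ⇒< t a (subst T (sym e) tt)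

<ᵇ≡false⇒≥ : ∀ {t a} → (t ℕ.<ᵇ a) ≡ false → a ℕ.≤ t
<ᵇ≡false⇒≥ e = ℕP.≮⇒≥ (λ t<a → subst T e (ℕP.<⇒<ᵇ t<a))

a≤t⇒t<a+x⇒t∸a<x : ∀ {a t x} → a ℕ.≤ t → t ℕ.< a ℕ.+ x → t ℕ.∸ a ℕ.< x
a≤t⇒t<a+x⇒t∸a<x {a} {t} {x} a≤t t< =
  ℕP.+-cancelˡ-< a (t ℕ.∸ a) x (subst (ℕ._< a ℕ.+ x) (sym (ℕP.m+[n∸m]≡n a≤t)) t<)

a≤t⇒t∸a<x⇒t<a+x : ∀ {a t x} → a ℕ.≤ t → t ℕ.∸ a ℕ.< x → t ℕ.< a ℕ.+ x
a≤t⇒t∸a<x⇒t<a+x {a} a≤t t∸a< = subst (ℕ._< a ℕ.+ _) (ℕP.m+[n∸m]≡n a≤t) (ℕP.+-monoʳ-< a t∸a<)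

a≤t⇒a+y≤t⇒y≤t∸a : ∀ {a t y} → a ℕ.≤ t → a ℕ.+ y ℕ.≤ t → y ℕ.≤ t ℕ.∸ a
a≤t⇒a+y≤t⇒y≤t∸a {a} {t} {y} a≤t le =
  ℕP.+-cancelˡ-≤ a y (t ℕ.∸ a) (subst (a ℕ.+ y ℕ.≤_) (sym (ℕP.m+[n∸m]≡n a≤t)) le)

a≤t⇒y≤t∸a⇒a+y≤t : ∀ {a t y} → a ℕ.≤ t → y ℕ.≤ t ℕ.∸ a → a ℕ.+ y ℕ.≤ t
a≤t⇒y≤t∸a⇒a+y≤t {a} a≤t le = subst (a ℕ.+ _ ℕ.≤_) (ℕP.m+[n∸m]≡n a≤t) (ℕP.+-monoʳ-≤ a le)

1≤block : ∀ {r} (w : Vec ℕ r) t → 1 ℕ.≤ block w t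
1≤block []      t = s≤s z≤n
1≤block (a ∷ w) t with t ℕ.<ᵇ a
... | true  = s≤s z≤n
... | false = s≤s z≤n

block-mono-suc : ∀ {r} (w : Vec ℕ r) t → block w t ℕ.≤ block w (suc t)
block-mono-suc []      t = ℕP.≤-refl
block-mono-suc (a ∷ w) t with t ℕ.<ᵇ a in e₁ | suc t ℕ.<ᵇ a in e₂
... | true  | true  = ℕP.≤-refl
... | true  | false = s≤s z≤n
... | false | true  =
  ⊥-elim (ℕP.<-irrefl refl (ℕP.≤-<-trans (<ᵇ≡false⇒≥ {t} {a} e₁) (ℕP.<-trans (ℕP.n<1+n t) (<ᵇ≡true⇒< {suc t} {a} e₂))))
... | false | false =
  s≤s (subst (λ k → block w (t ℕ.∸ a) ℕ.≤ block w k) (sym (ℕP.+-∸-assoc 1 (<ᵇ≡false⇒≥ {t} {a} e₁)))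
    (block-mono-suc w (t ℕ.∸ a)))

prefix-∷ : ∀ {r} a (w : Vec ℕ r) i → 1 ℕ.≤ i → prefix (a ∷ w) i ≡ a ℕ.+ prefix w (i ℕ.∸ 1)
prefix-∷ a w (suc i) _ = refl

prefix-mono : ∀ {r} (w : Vec ℕ r) {i j} → i ℕ.≤ j → prefix w i ℕ.≤ prefix w j
prefix-mono w       {zero}             _         = z≤n
prefix-mono []      {suc i} {suc j}    _         = z≤n
prefix-mono (a ∷ w) {suc i} {suc j} (s≤s i≤j) = ℕP.+-monoʳ-≤ a (prefix-mono w i≤j)

prefix-suc : ∀ {r} (w : Vec ℕ r) (i : Fin r) →
  prefix w (suc (toℕ i)) ≡ prefix w (toℕ i) ℕ.+ Vec.lookup w i
prefix-suc (a ∷ w) Fin.zero    = ℕP.+-comm a 0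
prefix-suc (a ∷ w) (Fin.suc i) = trans (cong (a ℕ.+_) (prefix-suc w i)) (sym (ℕP.+-assoc a _ _))

prefix≤sum : ∀ {r} (w : Vec ℕ r) {i} → i ℕ.≤ r → prefix w i ℕ.≤ sum (toList w)
prefix≤sum w {i} i≤r = subst (prefix w i ℕ.≤_) (prefix-all w) (prefix-mono w i≤r)
  where
  prefix-all : ∀ {r} (w : Vec ℕ r) → prefix w r ≡ sum (toList w)
  prefix-all []      = refl
  prefix-all (a ∷ w) = cong (a ℕ.+_) (prefix-all w)

block-bounds : ∀ {r} (w : Vec ℕ r) t → t ℕ.< sum (toList w) →
  block w t ℕ.≤ r × prefix w (block w t ℕ.∸ 1) ℕ.≤ t × t ℕ.< prefix w (block w t)
block-bounds (a ∷ w) t t< with t ℕ.<ᵇ a in e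
... | true  = s≤s z≤n , z≤n , subst (t ℕ.<_) (sym (ℕP.+-identityʳ a)) (<ᵇ≡true⇒< e)
... | false with a≤t ← <ᵇ≡false⇒≥ e
    with block≤r , lower , upper ← block-bounds w (t ℕ.∸ a) (a≤t⇒t<a+x⇒t∸a<x a≤t t<) =
  s≤s block≤r ,
  subst (ℕ._≤ t) (sym (prefix-∷ a w _ (1≤block w (t ℕ.∸ a)))) (a≤t⇒y≤t∸a⇒a+y≤t a≤t lower) ,
  a≤t⇒t∸a<x⇒t<a+x a≤t upper

block-unique : ∀ {r} (w : Vec ℕ r) i t → 1 ℕ.≤ i → i ℕ.≤ r →
  prefix w (i ℕ.∸ 1) ℕ.≤ t → t ℕ.< prefix w i → block w t ≡ i
block-unique []      (suc i) t _ () _ _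
block-unique (a ∷ w) i t _ _ lower upper with t ℕ.<ᵇ a in e
block-unique (a ∷ w) 1 t _ _ lower upper | true = refl
block-unique (a ∷ w) (suc (suc i)) t _ _ lower upper | true =
  ⊥-elim (ℕP.<-irrefl refl (ℕP.<-≤-trans (<ᵇ≡true⇒< e) (ℕP.≤-trans (ℕP.m≤m+n a _) lower)))
block-unique (a ∷ w) 1 t _ _ lower upper | false =
  ⊥-elim (ℕP.<-irrefl refl (ℕP.<-≤-trans upper (subst (ℕ._≤ t) (sym (ℕP.+-identityʳ a)) (<ᵇ≡false⇒≥ e))))
block-unique (a ∷ w) (suc (suc i)) t _ (s≤s i<r) lower upper | false =
  cong suc (block-unique w (suc i) (t ℕ.∸ a) (s≤s z≤n) i<r
    (a≤t⇒a+y≤t⇒y≤t∸a (<ᵇ≡false⇒≥ e) lower) (a≤t⇒t<a+x⇒t∸a<x (<ᵇ≡false⇒≥ e) upper))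

block-prefix+ : ∀ {r} (w : Vec ℕ r) (i : Fin r) {j} → j ℕ.< Vec.lookup w i →
  block w (prefix w (toℕ i) ℕ.+ j) ≡ suc (toℕ i)
block-prefix+ w i {j} j< = block-unique w (suc (toℕ i)) _ (s≤s z≤n) (FinP.toℕ<n i) (ℕP.m≤m+n _ _)
  (subst (prefix w (toℕ i) ℕ.+ j ℕ.<_) (sym (prefix-suc w i)) (ℕP.+-monoʳ-< (prefix w (toℕ i)) j<))

block-decompose : ∀ {r} (w : Vec ℕ r) t → t ℕ.< sum (toList w) →
  ∃ λ (i : Fin r) → block w t ≡ suc (toℕ i) ×
    ∃ λ j → j ℕ.< Vec.lookup w i × t ≡ prefix w (toℕ i) ℕ.+ j
block-decompose {r} w t t< with block w t | 1≤block w t | block-bounds w t t<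
... | suc b | _ | b<r , lower , upper =
  i , cong suc (sym toℕi) , t ℕ.∸ prefix w (toℕ i) ,
  a≤t⇒t<a+x⇒t∸a<x lower′ (subst (t ℕ.<_) (prefix-suc w i) (subst (λ k → t ℕ.< prefix w (suc k)) (sym toℕi) upper)) ,
  sym (ℕP.m+[n∸m]≡n lower′)
  where
  i : Fin r
  i = Fin.fromℕ< b<r
  toℕi : toℕ i ≡ b
  toℕi = FinP.toℕ-fromℕ< b<r
  lower′ : prefix w (toℕ i) ℕ.≤ t
  lower′ = subst (λ k → prefix w k ℕ.≤ t) (sym toℕi) lower

-- Finite sums

sumℤ : List ℤ → ℤ
sumℤ = List.foldr _+_ (+ 0)

sumBelow : (ℕ → ℤ) → ℕ → ℤ
sumBelow h zero    = + 0
sumBelow h (suc n) = sumBelow h n + h n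

module _ {A : Set} where

  remove : ∀ {x : A} {xs} → x ∈ xs → List A
  remove {xs = _ ∷ xs} (here _)  = xs
  remove {xs = y ∷ _}  (there p) = y ∷ remove p

  sumℤ-remove : (h : A → ℤ) {x : A} {xs : List A} (p : x ∈ xs) →
    sumℤ (List.map h xs) ≡ h x + sumℤ (List.map h (remove p))
  sumℤ-remove h (here refl) = refl
  sumℤ-remove h {x} {y ∷ _} (there p) = trans (cong (_+_ (h y)) (sumℤ-remove h p)) (swap (h y) (h x) _)
    where
    swap : ∀ a b c → a + (b + c) ≡ b + (a + c)
    swap = solve-∀

  length-remove : ∀ {x : A} {xs} (p : x ∈ xs) → length xs ≡ suc (length (remove p))
  length-remove (here _)  = refl
  length-remove (there p) = cong suc (length-remove p)

  ∈-remove⁻ : ∀ {x y : A} {xs} (p : x ∈ xs) → y ∈ remove p → y ∈ xs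
  ∈-remove⁻ (here _)  q         = there q
  ∈-remove⁻ (there p) (here e)  = here e
  ∈-remove⁻ (there p) (there q) = there (∈-remove⁻ p q)

  ∉-remove : ∀ {x : A} {xs} (p : x ∈ xs) → Unique xs → x ∉ remove p
  ∉-remove (here refl) (x∉ ∷ _) q         = All.lookup x∉ q refl
  ∉-remove (there p)   (y∉ ∷ _) (here refl) = All.lookup y∉ p refl
  ∉-remove (there p)   (_ ∷ u)  (there q) = ∉-remove p u q

  Unique-remove : ∀ {x : A} {xs} (p : x ∈ xs) → Unique xs → Unique (remove p)
  Unique-remove (here _)  (_ ∷ u)  = u
  Unique-remove (there p) (y∉ ∷ u) = All.tabulate (λ q → All.lookup y∉ (∈-remove⁻ p q)) ∷ Unique-remove p u

  Unique-map⁺-on : ∀ {B : Set} {f : A → B} {xs} →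
    (∀ {x y} → x ∈ xs → y ∈ xs → f x ≡ f y → x ≡ y) → Unique xs → Unique (List.map f xs)
  Unique-map⁺-on inj []        = []
  Unique-map⁺-on inj (x∉ ∷ u) =
    AllP.map⁺ (All.tabulate (λ y∈ fx≡fy → All.lookup x∉ y∈ (inj (here refl) (there y∈) fx≡fy))) ∷
    Unique-map⁺-on (λ p q → inj (there p) (there q)) u

  sumℤ-map-cong : (g h : A → ℤ) (xs : List A) → (∀ {x} → x ∈ xs → g x ≡ h x) →
    sumℤ (List.map g xs) ≡ sumℤ (List.map h xs)
  sumℤ-map-cong g h []       e = refl
  sumℤ-map-cong g h (x ∷ xs) e = cong₂ _+_ (e (here refl)) (sumℤ-map-cong g h xs (e ∘ there))

  sumℤ-map-− : (g h : A → ℤ) (xs : List A) →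
    sumℤ (List.map (λ x → g x - h x) xs) ≡ sumℤ (List.map g xs) - sumℤ (List.map h xs)
  sumℤ-map-− g h []       = refl
  sumℤ-map-− g h (x ∷ xs) = trans (cong (_+_ (g x - h x)) (sumℤ-map-− g h xs)) (regroup (g x) (h x) _ _)
    where
    regroup : ∀ a b c d → (a - b) + (c - d) ≡ (a + c) - (b + d)
    regroup = solve-∀

All-<-shrink : ∀ {n} {xs : List ℕ} → All (ℕ._< suc n) xs → n ∉ xs → All (ℕ._< n) xs
All-<-shrink below n∉ =
  All.tabulate (λ {y} y∈ → ℕP.≤∧≢⇒< (ℕP.≤-pred (All.lookup below y∈)) (λ y≡n → n∉ (subst (_∈ _) y≡n y∈)))

Unique-below⇒length≤ : ∀ n (xs : List ℕ) → Unique xs → All (ℕ._< n) xs → length xs ℕ.≤ n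
Unique-below⇒length≤ zero    []       _ _          = z≤n
Unique-below⇒length≤ zero    (_ ∷ _)  _ (() ∷ _)
Unique-below⇒length≤ (suc n) xs       u below with n ∈? xs
... | yes p = subst (ℕ._≤ suc n) (sym (length-remove p))
  (s≤s (Unique-below⇒length≤ n (remove p) (Unique-remove p u)
    (All-<-shrink (All.tabulate (All.lookup below ∘ ∈-remove⁻ p)) (∉-remove p u))))
... | no n∉ = ℕP.m≤n⇒m≤1+n (Unique-below⇒length≤ n xs u (All-<-shrink below n∉))

sumℤ-distinct-below : ∀ n (xs : List ℕ) → Unique xs → All (ℕ._< n) xs → length xs ≡ n →
  ∀ h → sumℤ (List.map h xs) ≡ sumBelow h n
sumℤ-distinct-below zero    []  _ _     _   h = refl
sumℤ-distinct-below (suc n) xs  u below len h with n ∈? xs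
... | yes p = trans (sumℤ-remove h p) (trans (ℤP.+-comm (h n) _)
  (cong (_+ h n) (sumℤ-distinct-below n (remove p) (Unique-remove p u)
    (All-<-shrink (All.tabulate (All.lookup below ∘ ∈-remove⁻ p)) (∉-remove p u))
    (ℕP.suc-injective (trans (sym (length-remove p)) len)) h)))
... | no n∉ = ⊥-elim (ℕP.<-irrefl refl (ℕP.<-≤-trans (subst (n ℕ.<_) (sym len) (ℕP.n<1+n n))
  (Unique-below⇒length≤ n xs u (All-<-shrink below n∉))))

sumℤ-applyUpTo : ∀ h n → sumℤ (List.applyUpTo h n) ≡ sumBelow h n
sumℤ-applyUpTo h n = trans (cong sumℤ (sym (ListP.map-upTo h n)))
  (sumℤ-distinct-below n (List.upTo n) (UniqueP.upTo⁺ n) (AllP.all-upTo n) (ListP.length-upTo n) h)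

sumBelow-cong : ∀ {g h : ℕ → ℤ} n → (∀ t → g t ≡ h t) → sumBelow g n ≡ sumBelow h n
sumBelow-cong zero    g≗h = refl
sumBelow-cong (suc n) g≗h = cong₂ _+_ (sumBelow-cong n g≗h) (g≗h n)

sumBelow-suc : ∀ (h : ℕ → ℤ) n → sumBelow (h ∘ suc) n + h 0 ≡ sumBelow h n + h n
sumBelow-suc h zero    = refl
sumBelow-suc h (suc n) =
  trans (swap (sumBelow (h ∘ suc) n) (h (suc n)) (h 0)) (cong (_+ h (suc n)) (sumBelow-suc h n))
  where
  swap : ∀ a b c → (a + b) + c ≡ (a + c) + b
  swap = solve-∀

sumBelow-− : ∀ (g h : ℕ → ℤ) n → sumBelow (λ t → g t - h t) n ≡ sumBelow g n - sumBelow h n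
sumBelow-− g h zero    = refl
sumBelow-− g h (suc n) =
  trans (cong (_+ (g n - h n)) (sumBelow-− g h n)) (regroup (sumBelow g n) (sumBelow h n) (g n) (h n))
  where
  regroup : ∀ a b c d → (a - b) + (c - d) ≡ (a + c) - (b + d)
  regroup = solve-∀

sumTo≡sumBelow : ∀ (σ : ℤ → ℤ) n → sumTo σ n ≡ sumBelow (σ ∘ +_ ∘ suc) n
sumTo≡sumBelow σ zero    = refl
sumTo≡sumBelow σ (suc n) = cong (_+ σ (+ suc n)) (sumTo≡sumBelow σ n)

sumBelow-suc≡tri : ∀ n → sumBelow (+_ ∘ suc) n ≡ tri n
sumBelow-suc≡tri n = trans (sumBelow≡gauss n)
  (cong +_ (trans (sym (ℕDiv.m*n/n≡m (gauss n) 2)) (cong (ℕ._/ 2) (2*gauss n))))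
  where
  gauss : ℕ → ℕ
  gauss zero    = 0
  gauss (suc n) = gauss n ℕ.+ suc n

  sumBelow≡gauss : ∀ n → sumBelow (+_ ∘ suc) n ≡ + gauss n
  sumBelow≡gauss zero    = refl
  sumBelow≡gauss (suc n) = trans (cong (_+ + suc n) (sumBelow≡gauss n)) (sym (ℤP.pos-+ (gauss n) (suc n)))

  2*gauss : ∀ n → gauss n ℕ.* 2 ≡ n ℕ.* suc n
  2*gauss zero    = refl
  2*gauss (suc n) = trans (distrib (gauss n) n) (trans (cong (ℕ._+ suc n ℕ.* 2) (2*gauss n)) (square n))
    where
    distrib : ∀ a n → (a ℕ.+ suc n) ℕ.* 2 ≡ a ℕ.* 2 ℕ.+ suc n ℕ.* 2
    distrib = ℕSolver.solve-∀
    square : ∀ n → n ℕ.* suc n ℕ.+ suc n ℕ.* 2 ≡ suc n ℕ.* suc (suc n)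
    square = ℕSolver.solve-∀

-- Ranks in a list of integers

rank : List ℤ → ℤ → ℕ
rank []       y = 0
rank (z ∷ xs) y with z ℤ.<? y
... | yes _ = suc (rank xs y)
... | no _  = rank xs y

rank≤length : ∀ xs y → rank xs y ℕ.≤ length xs
rank≤length []       y = z≤n
rank≤length (z ∷ xs) y with z ℤ.<? y
... | yes _ = s≤s (rank≤length xs y)
... | no _  = ℕP.m≤n⇒m≤1+n (rank≤length xs y)

rank-mono : ∀ xs {y y′} → y ℤ.≤ y′ → rank xs y ℕ.≤ rank xs y′
rank-mono []       le = z≤n
rank-mono (z ∷ xs) {y} {y′} le with z ℤ.<? y | z ℤ.<? y′
... | yes _   | yes _   = s≤s (rank-mono xs le)
... | yes z<y | no z≮y′ = ⊥-elim (z≮y′ (ℤP.<-≤-trans z<y le))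
... | no _    | yes _   = ℕP.m≤n⇒m≤1+n (rank-mono xs le)
... | no _    | no _    = rank-mono xs le

rank-< : ∀ xs {x y} → x ∈ xs → x ℤ.< y → rank xs x ℕ.< rank xs y
rank-< (z ∷ xs) {x} {y} (here refl) x<y with z ℤ.<? x | z ℤ.<? y
... | yes z<z | _       = ⊥-elim (ℤP.<-irrefl refl z<z)
... | no _    | yes _   = s≤s (rank-mono xs (ℤP.<⇒≤ x<y))
... | no _    | no z≮y  = ⊥-elim (z≮y x<y)
rank-< (z ∷ xs) {x} {y} (there p) x<y with z ℤ.<? x | z ℤ.<? y
... | yes _   | yes _   = s≤s (rank-< xs p x<y)
... | yes z<x | no z≮y  = ⊥-elim (z≮y (ℤP.<-trans z<x x<y))
... | no _    | yes _   = ℕP.m<n⇒m<1+n (rank-< xs p x<y)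
... | no _    | no _    = rank-< xs p x<y

rank<length : ∀ xs {x} → x ∈ xs → rank xs x ℕ.< length xs
rank<length (z ∷ xs) {x} (here refl) with z ℤ.<? x
... | yes z<z = ⊥-elim (ℤP.<-irrefl refl z<z)
... | no _    = s≤s (rank≤length xs x)
rank<length (z ∷ xs) {x} (there p) with z ℤ.<? x
... | yes _ = s≤s (rank<length xs p)
... | no _  = ℕP.m<n⇒m<1+n (rank<length xs p)

rank-reflects-< : ∀ xs {x y} → y ∈ xs → rank xs x ℕ.< rank xs y → x ℤ.< y
rank-reflects-< xs {x} {y} y∈ r< with ℤP.<-cmp x y
... | tri< x<y _ _    = x<y
... | tri≈ _ refl _   = ⊥-elim (ℕP.<-irrefl refl r<)
... | tri> _ _ y<x    = ⊥-elim (ℕP.<-asym r< (rank-< xs y∈ y<x))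

rank-surjective : ∀ xs → Unique xs → ∀ c → c ℕ.< length xs → ∃ λ y → y ∈ xs × rank xs y ≡ c
rank-surjective (z ∷ xs) (z∉ ∷ u) c c< with ℕP.<-cmp c (rank xs z)
... | tri≈ _ c≡ _ = z , here refl , trans rank-z (sym c≡)
  where
  rank-z : rank (z ∷ xs) z ≡ rank xs z
  rank-z with z ℤ.<? z
  ... | yes z<z = ⊥-elim (ℤP.<-irrefl refl z<z)
  ... | no _    = refl
... | tri< c<rz _ _ with y , y∈ , ry ← rank-surjective xs u c (ℕP.<-≤-trans c<rz (rank≤length xs z)) =
  y , there y∈ , rank-y
  where
  rank-y : rank (z ∷ xs) y ≡ c
  rank-y with z ℤ.<? y
  ... | yes z<y =
    ⊥-elim (ℕP.<-irrefl refl (ℕP.<-≤-trans c<rz (subst (rank xs z ℕ.≤_) ry (rank-mono xs (ℤP.<⇒≤ z<y)))))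
  ... | no _    = ry
rank-surjective (z ∷ xs) (z∉ ∷ u) (suc c) (s≤s c<) | tri> _ _ rz<c
  with y , y∈ , ry ← rank-surjective xs u c c< = y , there y∈ , rank-y
  where
  rank-y : rank (z ∷ xs) y ≡ suc c
  rank-y with z ℤ.<? y
  ... | yes _ = cong suc ry
  ... | no z≮y with ℤP.<-cmp y z
  ...   | tri< y<z _ _ =
    ⊥-elim (ℕP.<-irrefl refl (ℕP.≤-<-trans (ℕP.≤-pred rz<c) (subst (ℕ._< rank xs z) ry (rank-< xs y∈ y<z))))
  ...   | tri≈ _ refl _ = ⊥-elim (All.lookup z∉ y∈ refl)
  ...   | tri> _ _ z<y = ⊥-elim (z≮y z<y)

module _ (m : ℕ) .{{_ : NonZero m}} where

  ≡-mod⇒≡+* : ∀ x y → x %ℕ m ≡ y %ℕ m → y ≡ x + (y /ℕ m - x /ℕ m) * + m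
  ≡-mod⇒≡+* x y x≡y = begin
    y                                                   ≡⟨ a≡a%ℕn+[a/ℕn]*n y m ⟩
    + (y %ℕ m) + (y /ℕ m) * + m                         ≡⟨ cong (λ t → + t + (y /ℕ m) * + m) (sym x≡y) ⟩
    + (x %ℕ m) + (y /ℕ m) * + m                         ≡⟨ regroup (+ (x %ℕ m)) (x /ℕ m) (y /ℕ m) (+ m) ⟩
    (+ (x %ℕ m) + (x /ℕ m) * + m) + (y /ℕ m - x /ℕ m) * + m
      ≡⟨ cong (_+ (y /ℕ m - x /ℕ m) * + m) (sym (a≡a%ℕn+[a/ℕn]*n x m)) ⟩
    x + (y /ℕ m - x /ℕ m) * + m                         ∎
    where
    open ≡-Reasoning
    regroup : ∀ t p q M → t + q * M ≡ (t + p * M) + (q - p) * M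
    regroup = solve-∀

  1+s≡1+t+k*m⇒s≡t : ∀ {s t} k → s ℕ.< m → t ℕ.< m → + suc s ≡ + suc t + k * + m → s ≡ t
  1+s≡1+t+k*m⇒s≡t {s} {t} k s<m t<m e =
    proj₂ (representation-unique (+ 0) k s<m t<m
      (+-cancelˡ (+ 1) _ _ (trans (drop-zero (+ s) (+ m)) (trans e (regroup (+ t) k (+ m))))))
    where
    drop-zero : ∀ s M → + 1 + (s + + 0 * M) ≡ + 1 + s
    drop-zero = solve-∀
    regroup : ∀ t k M → (+ 1 + t) + k * M ≡ + 1 + (t + k * M)
    regroup = solve-∀

  sumℤ-residues : (g : ℤ → ℤ) → (∀ x → g (x + + m) ≡ g x) → (xs : List ℤ) →
    AllPairs (λ a b → a %ℕ m ≢ b %ℕ m) xs → length xs ≡ m → sumℤ (List.map g xs) ≡ sumBelow (g ∘ +_) m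
  sumℤ-residues g periodic xs distinct len = begin
    sumℤ (List.map g xs)                              ≡⟨ sumℤ-map-cong g (g ∘ +_ ∘ (_%ℕ m)) xs (λ {x} _ → g-residue x) ⟩
    sumℤ (List.map (g ∘ +_ ∘ (_%ℕ m)) xs)             ≡⟨ cong sumℤ (ListP.map-∘ xs) ⟩
    sumℤ (List.map (g ∘ +_) (List.map (_%ℕ m) xs))    ≡⟨ sumℤ-distinct-below m _ (AllPairsP.map⁺ distinct)
                                                           (AllP.map⁺ (All.tabulate (λ {x} _ → n%ℕd<d x m)))
                                                           (trans (ListP.length-map _ xs) len) (g ∘ +_) ⟩
    sumBelow (g ∘ +_) m                               ∎
    where
    open ≡-Reasoning
    g-residue : ∀ x → g x ≡ g (+ (x %ℕ m))
    g-residue x = begin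
      g x                                     ≡⟨ cong g (a≡a%ℕn+[a/ℕn]*n x m) ⟩
      g (+ (x %ℕ m) + (x /ℕ m) * + m)
        ≡⟨ shift-multiple g (λ y → trans (periodic y) (sym (ℤP.+-identityʳ (g y)))) _ (x /ℕ m) ⟩
      g (+ (x %ℕ m)) + (x /ℕ m) * + 0         ≡⟨ cong (_+_ (g (+ (x %ℕ m)))) (ℤP.*-zeroʳ (x /ℕ m)) ⟩
      g (+ (x %ℕ m)) + + 0                    ≡⟨ ℤP.+-identityʳ _ ⟩
      g (+ (x %ℕ m))                          ∎

  sumTo≡displacement+tri : (σ : ℤ → ℤ) → (∀ x → σ (x + + m) ≡ σ x + + m) →
    sumTo σ m ≡ sumBelow (λ t → σ (+ t) - + t) m + tri m
  sumTo≡displacement+tri σ periodic = begin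
    sumTo σ m                                                   ≡⟨ sumTo≡sumBelow σ m ⟩
    sumBelow (σ ∘ +_ ∘ suc) m                                   ≡⟨ shifted-sum ⟩
    sumBelow (σ ∘ +_) m + + m                                   ≡⟨ regroup (sumBelow (σ ∘ +_) m) (sumBelow +_ m) (+ m) ⟩
    (sumBelow (σ ∘ +_) m - sumBelow +_ m) + (sumBelow +_ m + + m)
      ≡⟨ cong₂ _+_ (sym (sumBelow-− (σ ∘ +_) +_ m)) shifted-tri ⟩
    sumBelow (λ t → σ (+ t) - + t) m + tri m                    ∎
    where
    open ≡-Reasoning
    regroup : ∀ S T M → S + M ≡ (S - T) + (T + M)
    regroup = solve-∀
    swap : ∀ S a M → S + (a + M) ≡ (S + M) + a
    swap = solve-∀

    shifted-sum : sumBelow (σ ∘ +_ ∘ suc) m ≡ sumBelow (σ ∘ +_) m + + m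
    shifted-sum = +-cancelʳ (σ (+ 0)) _ _ (trans (sumBelow-suc (σ ∘ +_) m)
      (trans (cong (_+_ (sumBelow (σ ∘ +_) m)) (periodic (+ 0))) (swap (sumBelow (σ ∘ +_) m) (σ (+ 0)) (+ m))))

    shifted-tri : sumBelow +_ m + + m ≡ tri m
    shifted-tri = trans (sym (sumBelow-suc +_ m)) (trans (ℤP.+-identityʳ _) (sumBelow-suc≡tri m))

-- The staircase f_w and minimal coset representatives

module Staircase (m : ℕ) .{{_ : NonZero m}} {r : ℕ} (w : Vec ℕ r) (sum-w : sum (toList w) ≡ m) where

  F : ℤ → ℤ
  F = fw m w

  <m⇒<sum : ∀ {t} → t ℕ.< m → t ℕ.< sum (toList w)
  <m⇒<sum {t} = subst (t ℕ.<_) (sym sum-w)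

  block≤r : ∀ {t} → t ℕ.< m → block w t ℕ.≤ r
  block≤r t<m = proj₁ (block-bounds w _ (<m⇒<sum t<m))

  decompose : ∀ x → ∃ λ t → ∃ λ q → t ℕ.< m × x ≡ + suc t + q * + m
  decompose x = (x - + 1) %ℕ m , (x - + 1) /ℕ m , n%ℕd<d (x - + 1) m ,
    trans (add-one x) (trans (cong (_+_ (+ 1)) (a≡a%ℕn+[a/ℕn]*n (x - + 1) m))
      (sym (ℤP.+-assoc (+ 1) (+ ((x - + 1) %ℕ m)) (((x - + 1) /ℕ m) * + m))))
    where
    add-one : ∀ x → x ≡ + 1 + (x - + 1)
    add-one = solve-∀

  fw-char : ∀ t q → t ℕ.< m → F (+ suc t + q * + m) ≡ q * + r + + block w t
  fw-char t q t<m = cong₂ (λ p s → p * + r + + block w s) (proj₁ division) (proj₂ division)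
    where
    minus-one : ∀ t q M → (+ 1 + t) + q * M - + 1 ≡ t + q * M
    minus-one = solve-∀
    division : (+ suc t + q * + m - + 1) /ℕ m ≡ q × (+ suc t + q * + m - + 1) %ℕ m ≡ t
    division = divMod-unique m q t<m (minus-one (+ t) q (+ m))

  fw-periodic : ∀ x → F (x + + m) ≡ F x + + r
  fw-periodic x with t , q , t<m , refl ← decompose x = begin
    F ((+ suc t + q * + m) + + m)    ≡⟨ cong F (next-quotient (+ suc t) q (+ m)) ⟩
    F (+ suc t + (q + + 1) * + m)    ≡⟨ fw-char t (q + + 1) t<m ⟩
    (q + + 1) * + r + + block w t    ≡⟨ sym (next-quotient′ q (+ r) (+ block w t)) ⟩
    (q * + r + + block w t) + + r    ≡⟨ cong (_+ + r) (sym (fw-char t q t<m)) ⟩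
    F (+ suc t + q * + m) + + r      ∎
    where
    open ≡-Reasoning
    next-quotient : ∀ s q M → (s + q * M) + M ≡ s + (q + + 1) * M
    next-quotient = solve-∀
    next-quotient′ : ∀ q R b → (q * R + b) + R ≡ (q + + 1) * R + b
    next-quotient′ = solve-∀

  next-in-period : ∀ t q → + suc t + q * + m + + 1 ≡ + suc (suc t) + q * + m
  next-in-period t q = regroup (+ t) q (+ m)
    where
    regroup : ∀ t q M → (+ 1 + t) + q * M + + 1 ≡ (+ 1 + (+ 1 + t)) + q * M
    regroup = solve-∀

  next-period : ∀ t q → suc t ≡ m → + suc t + q * + m + + 1 ≡ + 1 + (q + + 1) * + m
  next-period t q 1+t≡m = trans (cong (λ k → + k + q * + m + + 1) 1+t≡m) (regroup q (+ m))
    where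
    regroup : ∀ q M → M + q * M + + 1 ≡ + 1 + (q + + 1) * M
    regroup = solve-∀

  fw-<-across-period : ∀ t q → t ℕ.< m → suc t ≡ m →
    F (+ suc t + q * + m) ℤ.< F (+ suc t + q * + m + + 1)
  fw-<-across-period t q t<m 1+t≡m = begin-strict
    F (+ suc t + q * + m)                ≡⟨ fw-char t q t<m ⟩
    q * + r + + block w t                ≤⟨ ℤP.+-monoʳ-≤ (q * + r) (+≤+ (block≤r t<m)) ⟩
    q * + r + + r                        <⟨ ℤP.≤-<-trans (ℤP.≤-reflexive (regroup q (+ r)))
                                              (ℤP.+-monoʳ-< ((q + + 1) * + r) (+<+ (1≤block w 0))) ⟩
    (q + + 1) * + r + + block w 0        ≡⟨ sym (fw-char 0 (q + + 1) (ℕP.≤-<-trans z≤n t<m)) ⟩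
    F (+ 1 + (q + + 1) * + m)            ≡⟨ cong F (sym (next-period t q 1+t≡m)) ⟩
    F (+ suc t + q * + m + + 1)          ∎
    where
    open ℤP.≤-Reasoning
    regroup : ∀ q R → q * R + R ≡ (q + + 1) * R + + 0
    regroup = solve-∀

  fw-mono-suc : ∀ x → F x ℤ.≤ F (x + + 1)
  fw-mono-suc x with t , q , t<m , refl ← decompose x with suc t ℕ.<? m
  ... | yes 1+t<m = begin
    F (+ suc t + q * + m)                ≡⟨ fw-char t q t<m ⟩
    q * + r + + block w t                ≤⟨ ℤP.+-monoʳ-≤ (q * + r) (+≤+ (block-mono-suc w t)) ⟩
    q * + r + + block w (suc t)          ≡⟨ sym (fw-char (suc t) q 1+t<m) ⟩
    F (+ suc (suc t) + q * + m)          ≡⟨ cong F (sym (next-in-period t q)) ⟩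
    F (+ suc t + q * + m + + 1)          ∎
    where open ℤP.≤-Reasoning
  ... | no 1+t≮m = ℤP.<⇒≤ (fw-<-across-period t q t<m (ℕP.≤-antisym t<m (ℕP.≮⇒≥ 1+t≮m)))

  fw-mono : ∀ {x y} → x ℤ.≤ y → F x ℤ.≤ F y
  fw-mono {x} x≤y with k , refl ← i≤j⇒∃[k]j≡i+k x≤y = gap k
    where
    one-more : ∀ x k → (x + k) + + 1 ≡ x + (+ 1 + k)
    one-more = solve-∀
    gap : ∀ k → F x ℤ.≤ F (x + + k)
    gap zero    = ℤP.≤-reflexive (cong F (sym (ℤP.+-identityʳ x)))
    gap (suc k) = ℤP.≤-trans (gap k) (ℤP.≤-trans (fw-mono-suc (x + + k)) (ℤP.≤-reflexive (cong F (one-more x (+ k)))))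

  fw-reflects-< : ∀ {x y} → F x ℤ.< F y → x ℤ.< y
  fw-reflects-< {x} {y} Fx<Fy = ℤP.≰⇒> (λ y≤x → ℤP.<⇒≱ Fx<Fy (fw-mono y≤x))

  fw-constant-step : ∀ t q → t ℕ.< m → F (+ suc t + q * + m) ≡ F (+ suc t + q * + m + + 1) →
    suc t ℕ.< m × block w t ≡ block w (suc t)
  fw-constant-step t q t<m Fx≡ with suc t ℕ.<? m
  ... | yes 1+t<m = 1+t<m , ℤP.+-injective (+-cancelˡ (q * + r) _ _ (begin
    q * + r + + block w t                ≡⟨ sym (fw-char t q t<m) ⟩
    F (+ suc t + q * + m)                ≡⟨ Fx≡ ⟩
    F (+ suc t + q * + m + + 1)          ≡⟨ cong F (next-in-period t q) ⟩
    F (+ suc (suc t) + q * + m)          ≡⟨ fw-char (suc t) q 1+t<m ⟩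
    q * + r + + block w (suc t)          ∎))
    where open ≡-Reasoning
  ... | no 1+t≮m =
    ⊥-elim (ℤP.<-irrefl Fx≡ (fw-<-across-period t q t<m (ℕP.≤-antisym t<m (ℕP.≮⇒≥ 1+t≮m))))

  fw-window : ∀ {t} → t ℕ.< m → F (+ suc t) ≡ + block w t
  fw-window {t} t<m = trans (cong F (sym (no-shift (+ suc t) (+ m))))
                            (trans (fw-char t (+ 0) t<m) (no-shift′ (+ block w t) (+ r)))
    where
    no-shift : ∀ x M → x + + 0 * M ≡ x
    no-shift = solve-∀
    no-shift′ : ∀ b R → + 0 * R + b ≡ b
    no-shift′ = solve-∀

  fw-window-range : ∀ {t} → t ℕ.< m → + 1 ℤ.≤ F (+ suc t) × F (+ suc t) ℤ.≤ + r
  fw-window-range {t} t<m rewrite fw-window t<m = +≤+ (1≤block w t) , +≤+ (block≤r t<m)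

  fw-nonpositive : ∀ {v} → v ℤ.≤ + 0 → F v ℤ.≤ + 0
  fw-nonpositive v≤0 = ℤP.≤-trans (fw-mono v≤0) (begin
    F (+ 0)                     ≡⟨ add-sub (F (+ 0)) (+ r) ⟩
    (F (+ 0) + + r) - + r       ≡⟨ cong (_- + r) (sym (fw-periodic (+ 0))) ⟩
    F (+ m) - + r               ≡⟨ cong (λ k → F (+ k) - + r) (sym (ℕP.suc-pred m)) ⟩
    F (+ suc (ℕ.pred m)) - + r  ≤⟨ ℤP.+-monoˡ-≤ (- + r) (proj₂ (fw-window-range pred-m<m)) ⟩
    + r - + r                   ≡⟨ ℤP.+-inverseʳ (+ r) ⟩
    + 0                         ∎)
    where
    open ℤP.≤-Reasoning
    add-sub : ∀ a b → a ≡ (a + b) - b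
    add-sub = solve-∀
    pred-m<m : ℕ.pred m ℕ.< m
    pred-m<m = subst (ℕ.pred m ℕ.<_) (ℕP.suc-pred m) (ℕP.n<1+n _)

  fw-beyond-window : ∀ {v} → + suc m ℤ.≤ v → + r ℤ.< F v
  fw-beyond-window m<v = ℤP.<-≤-trans (begin-strict
    + r                ≡⟨ sym (ℤP.+-identityˡ (+ r)) ⟩
    + 0 + + r          <⟨ ℤP.+-monoˡ-< (+ r) (ℤP.<-≤-trans (+<+ (s≤s z≤n)) (proj₁ (fw-window-range 0<m))) ⟩
    F (+ 1) + + r      ≡⟨ sym (fw-periodic (+ 1)) ⟩
    F (+ suc m)        ∎) (fw-mono m<v)
    where
    open ℤP.≤-Reasoning
    0<m : 0 ℕ.< m
    0<m = ℕ.>-nonZero⁻¹ m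

  fw-window⁻¹ : ∀ v → + 1 ℤ.≤ F v → F v ℤ.≤ + r → ∃ λ t → t ℕ.< m × v ≡ + suc t
  fw-window⁻¹ v lower upper with v ℤ.≤? + 0 | + suc m ℤ.≤? v
  ... | yes v≤0 | _ = ⊥-elim (ℤP.<-irrefl refl (ℤP.<-≤-trans (+<+ (s≤s z≤n)) (ℤP.≤-trans lower (fw-nonpositive v≤0))))
  ... | no _ | yes m<v = ⊥-elim (ℤP.<-irrefl refl (ℤP.<-≤-trans (fw-beyond-window m<v) upper))
  ... | no v≰0 | no m≮v with ℤP.≰⇒> v≰0 | ℤP.≰⇒> m≮v
  -- 0 < v forces v = + suc t, and then v < + suc m is t < m.
  ... | +<+ (s≤s {n = t} z≤n) | +<+ (s≤s t<m) = t , t<m , refl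

  fw-fibre-width : 1 ℕ.≤ r → ∀ a v → F v ≡ F a → a - + m ℤ.< v
  fw-fibre-width 1≤r a v Fv≡Fa with (a - + m) ℤ.<? v
  ... | yes a-m<v = a-m<v
  ... | no a-m≮v = ⊥-elim (ℤP.<-irrefl refl (ℤP.≤-<-trans Fa≤F[a-m] F[a-m]<Fa))
    where
    Fa≤F[a-m] : F a ℤ.≤ F (a - + m)
    Fa≤F[a-m] = ℤP.≤-trans (ℤP.≤-reflexive (sym Fv≡Fa)) (fw-mono (ℤP.≮⇒≥ a-m≮v))
    sub-add : ∀ a M → (a - M) + M ≡ a
    sub-add = solve-∀
    F[a-m]<Fa : F (a - + m) ℤ.< F a
    F[a-m]<Fa = begin-strict
      F (a - + m)              ≡⟨ sym (ℤP.+-identityʳ _) ⟩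
      F (a - + m) + + 0        <⟨ ℤP.+-monoʳ-< (F (a - + m)) (+<+ 1≤r) ⟩
      F (a - + m) + + r        ≡⟨ sym (fw-periodic (a - + m)) ⟩
      F ((a - + m) + + m)      ≡⟨ cong F (sub-add a (+ m)) ⟩
      F a                      ∎
      where open ℤP.≤-Reasoning

  module CosetRepresentative (σ : ℤ → ℤ) (perm : IsAffinePerm m σ) (rep : IsMinCosetRep w σ) where
    open IsAffinePerm perm

    σ⁻¹ : ℤ → ℤ
    σ⁻¹ a = proj₁ (surjective a)

    σ∘σ⁻¹ : ∀ a → σ (σ⁻¹ a) ≡ a
    σ∘σ⁻¹ a = proj₂ (surjective a)

    σ⁻¹∘σ : ∀ x → σ⁻¹ (σ x) ≡ x
    σ⁻¹∘σ x = injective _ _ (σ∘σ⁻¹ (σ x))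

    σ⁻¹-injective : ∀ {a b} → σ⁻¹ a ≡ σ⁻¹ b → a ≡ b
    σ⁻¹-injective {a} {b} e = trans (sym (σ∘σ⁻¹ a)) (trans (cong σ e) (σ∘σ⁻¹ b))

    σ-shift : ∀ x k → σ (x + k * + m) ≡ σ x + k * + m
    σ-shift = shift-multiple σ periodic

    -- Translating by a multiple of m moves a into the window 1, …, m, where F is
    -- block w and the claim is the coset condition for the block of a.
    σ⁻¹-<-step : ∀ x y a → σ x ≡ a → σ y ≡ a + + 1 → F a ≡ F (a + + 1) → x ℤ.< y
    σ⁻¹-<-step x y a σx≡a σy≡a+1 Fa≡ with t , q , t<m , refl ← decompose a
      with 1+t<m , same-block ← fw-constant-step t q t<m Fa≡
      with i≤r , lower , _ ← block-bounds w t (<m⇒<sum t<m)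
      with _ , _ , upper ← block-bounds w (suc t) (<m⇒<sum 1+t<m) =
      subst₂ ℤ._<_ (unshift x) (unshift y) (ℤP.+-monoˡ-< (q * + m) shifted)
      where
      unshift : ∀ x → (x + - q * + m) + q * + m ≡ x
      unshift x = cancel x q (+ m)
        where
        cancel : ∀ x q M → (x + - q * M) + q * M ≡ x
        cancel = solve-∀
      back : ∀ s → (s + q * + m) + - q * + m ≡ s
      back s = cancel s q (+ m)
        where
        cancel : ∀ s q M → (s + q * M) + - q * M ≡ s
        cancel = solve-∀
      shifted : x + - q * + m ℤ.< y + - q * + m
      shifted = rep (block w t) (suc t) (1≤block w t) i≤r (s≤s lower)
        (subst (λ i → suc (suc t) ℕ.≤ prefix w i) (sym same-block) upper) _ _
        (trans (σ-shift x (- q)) (trans (cong (_+ - q * + m) σx≡a) (back (+ suc t))))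
        (trans (σ-shift y (- q)) (trans (cong (_+ - q * + m) (trans σy≡a+1 (next-in-period t q))) (back (+ suc (suc t)))))

    σ⁻¹-<-on-fibres : ∀ x y → σ x ℤ.< σ y → F (σ x) ≡ F (σ y) → x ℤ.< y
    σ⁻¹-<-on-fibres x y σx<σy Fσx≡Fσy with k , σy≡ ← i<j⇒∃[k]j≡i+1+k σx<σy =
      gap k x y (σ x) refl σy≡ (trans Fσx≡Fσy (cong F σy≡))
      where
      one-more : ∀ a k → a + (+ 1 + (+ 1 + k)) ≡ (a + + 1) + (+ 1 + k)
      one-more = solve-∀
      gap : ∀ k x y a → σ x ≡ a → σ y ≡ a + + suc k → F a ≡ F (a + + suc k) → x ℤ.< y
      gap zero    = σ⁻¹-<-step
      gap (suc k) x y a σx≡a σy≡ Fa≡ =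
        ℤP.<-trans (σ⁻¹-<-step x (σ⁻¹ (a + + 1)) a σx≡a (σ∘σ⁻¹ _) Fa≡F[a+1])
          (gap k (σ⁻¹ (a + + 1)) y (a + + 1) (σ∘σ⁻¹ _) (trans σy≡ (one-more a (+ k)))
            (trans (sym Fa≡F[a+1]) (trans Fa≡ (cong F (one-more a (+ k))))))
        where
        Fa≡F[a+1] : F a ≡ F (a + + 1)
        Fa≡F[a+1] = ℤP.≤-antisym (fw-mono-suc a)
          (ℤP.≤-trans (fw-mono (ℤP.+-monoʳ-≤ a (+≤+ (s≤s z≤n)))) (ℤP.≤-reflexive (sym Fa≡)))

  module _ (1≤r : 1 ℕ.≤ r) (σ τ : ℤ → ℤ)
           (σ-perm : IsAffinePerm m σ) (σ-rep : IsMinCosetRep w σ)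
           (τ-perm : IsAffinePerm m τ) (τ-rep : IsMinCosetRep w τ)
           (same : ∀ x → F (σ x) ≡ F (τ x)) where
    private
      module Sσ = CosetRepresentative σ σ-perm σ-rep
      module Sτ = CosetRepresentative τ τ-perm τ-rep

    -- If σ y < τ y, then z = τ⁻¹ (σ y) again has σ z < τ z, with τ z < τ y in the same
    -- fibre of F.  A fibre of F is shorter than m, and n counts the room left above
    -- τ x - m, so this descent must stop.
    σ≮τ-from : ∀ x n y → F (τ y) ≡ F (τ x) → τ y ℤ.≤ (τ x - + m) + + n → ¬ σ y ℤ.< τ y
    σ≮τ-from x zero y Fτy≡ τy≤ σy<τy =
      ℤP.<-irrefl refl (ℤP.<-≤-trans (fw-fibre-width 1≤r (τ x) (τ y) Fτy≡)
        (ℤP.≤-trans τy≤ (ℤP.≤-reflexive (ℤP.+-identityʳ _))))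
    σ≮τ-from x (suc n) y Fτy≡ τy≤ σy<τy = descend (Sτ.σ⁻¹ (σ y)) (Sτ.σ∘σ⁻¹ (σ y))
      where
      z<y : ∀ z → τ z ≡ σ y → z ℤ.< y
      z<y z τz≡σy = Sτ.σ⁻¹-<-on-fibres z y (subst (ℤ._< τ y) (sym τz≡σy) σy<τy) (trans (cong F τz≡σy) (same y))

      descend : ∀ z → τ z ≡ σ y → ⊥
      descend z τz≡σy with ℤP.<-cmp (σ z) (σ y)
      ... | tri< σz<σy _ _ =
        σ≮τ-from x n z (trans (cong F τz≡σy) (trans (same y) Fτy≡))
          (i<j+1+k⇒i≤j+k (τ x - + m) n (ℤP.<-≤-trans (subst (ℤ._< τ y) (sym τz≡σy) σy<τy) τy≤))
          (subst (σ z ℤ.<_) (sym τz≡σy) σz<σy)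
      ... | tri≈ _ σz≡σy _ = ℤP.<-irrefl (IsAffinePerm.injective σ-perm _ _ σz≡σy) (z<y z τz≡σy)
      ... | tri> _ _ σy<σz =
        ℤP.<-asym (z<y z τz≡σy) (Sσ.σ⁻¹-<-on-fibres y z σy<σz (trans (sym (cong F τz≡σy)) (sym (same z))))

    σ≮τ : ∀ x → ¬ σ x ℤ.< τ x
    σ≮τ x = σ≮τ-from x m x refl (ℤP.≤-reflexive (add-sub (τ x) (+ m)))
      where
      add-sub : ∀ a M → a ≡ (a - M) + M
      add-sub = solve-∀

  coset-representatives-agree : 1 ℕ.≤ r → ∀ σ τ →
    IsAffinePerm m σ → IsMinCosetRep w σ → IsAffinePerm m τ → IsMinCosetRep w τ →
    (∀ x → F (σ x) ≡ F (τ x)) → ∀ x → σ x ≡ τ x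
  coset-representatives-agree 1≤r σ τ σ-perm σ-rep τ-perm τ-rep same x with ℤP.<-cmp (σ x) (τ x)
  ... | tri< σx<τx _ _ = ⊥-elim (σ≮τ 1≤r σ τ σ-perm σ-rep τ-perm τ-rep same x σx<τx)
  ... | tri≈ _ σx≡τx _ = σx≡τx
  ... | tri> _ _ τx<σx = ⊥-elim (σ≮τ 1≤r τ σ τ-perm τ-rep σ-perm σ-rep (sym ∘ same) x τx<σx)

  module Forward (n : ℕ) (σ : ℤ → ℤ) (perm : IsAffinePerm m σ) (rep : IsMinCosetRep w σ)
                 (increasing : ∀ x → σ x ℤ.< σ (x + ι n)) where
    open IsAffinePerm perm
    open CosetRepresentative σ perm rep

    preimage : ℕ → ℕ → List ℤ
    preimage a k = List.applyUpTo (λ j → σ⁻¹ (+ suc (a ℕ.+ j))) k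

    ∈-preimage⁺ : ∀ {a k x j} → j ℕ.< k → σ x ≡ + suc (a ℕ.+ j) → x ∈ preimage a k
    ∈-preimage⁺ {a} {k} {x} j<k σx≡ =
      subst (_∈ preimage a k) (trans (cong σ⁻¹ (sym σx≡)) (σ⁻¹∘σ x)) (∈P.∈-applyUpTo⁺ _ j<k)

    ∈-preimage⁻ : ∀ {a k x} → x ∈ preimage a k → ∃ λ j → j ℕ.< k × σ x ≡ + suc (a ℕ.+ j)
    ∈-preimage⁻ x∈ with j , j<k , refl ← ∈P.∈-applyUpTo⁻ _ x∈ = j , j<k , σ∘σ⁻¹ _

    preimage-unique : ∀ a k → Unique (preimage a k)
    preimage-unique a k = UniqueP.applyUpTo⁺₁ _ k
      (λ i<j _ e → ℕP.<⇒≢ i<j (ℕP.+-cancelˡ-≡ a _ _ (ℕP.suc-injective (ℤP.+-injective (σ⁻¹-injective e)))))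

    window : List ℤ
    window = preimage 0 m

    window-complete : ∀ x → (x ∈ window) ⇔ ((+ 1 ℤ.≤ F (σ x)) × (F (σ x) ℤ.≤ ι r))
    window-complete x = mk⇔ to from
      where
      to : x ∈ window → (+ 1 ℤ.≤ F (σ x)) × (F (σ x) ℤ.≤ ι r)
      to x∈ with j , j<m , σx≡ ← ∈-preimage⁻ x∈ rewrite σx≡ = fw-window-range j<m
      from : (+ 1 ℤ.≤ F (σ x)) × (F (σ x) ℤ.≤ ι r) → x ∈ window
      from (lower , upper) with t , t<m , σx≡ ← fw-window⁻¹ (σ x) lower upper = ∈-preimage⁺ t<m σx≡

    window-distinct-mod : AllPairs (λ a b → a %ℕ m ≢ b %ℕ m) window
    window-distinct-mod = AllPairsP.applyUpTo⁺₁ _ m distinct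
      where
      distinct : ∀ {i j} → i ℕ.< j → j ℕ.< m → σ⁻¹ (+ suc i) %ℕ m ≢ σ⁻¹ (+ suc j) %ℕ m
      distinct {i} {j} i<j j<m ≡mod = ℕP.<⇒≢ i<j (sym (1+s≡1+t+k*m⇒s≡t m k j<m (ℕP.<-trans i<j j<m) (begin
        + suc j                  ≡⟨ sym (σ∘σ⁻¹ _) ⟩
        σ xⱼ                     ≡⟨ cong σ (≡-mod⇒≡+* m xᵢ xⱼ ≡mod) ⟩
        σ (xᵢ + k * + m)         ≡⟨ σ-shift xᵢ k ⟩
        σ xᵢ + k * + m           ≡⟨ cong (_+ k * + m) (σ∘σ⁻¹ _) ⟩
        + suc i + k * + m        ∎)))
        where
        open ≡-Reasoning
        xᵢ xⱼ : ℤ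
        xᵢ = σ⁻¹ (+ suc i)
        xⱼ = σ⁻¹ (+ suc j)
        k : ℤ
        k = xⱼ /ℕ m - xᵢ /ℕ m

    displacement-sum : sumBelow (λ t → σ (+ t) - + t) m ≡ + 0
    displacement-sum = +-cancelʳ (tri m) _ _ (trans (sym (sumTo≡displacement+tri m σ periodic))
                                               (trans window-sum (sym (ℤP.+-identityˡ (tri m)))))

    window-total : sumℤ window ≡ tri m
    window-total = begin
      sumℤ window                                              ≡⟨ cong sumℤ (sym (ListP.map-id window)) ⟩
      sumℤ (List.map id window)                                ≡⟨ sumℤ-map-cong id _ window (λ {x} _ → sub-sub (σ x) x) ⟩
      sumℤ (List.map (λ x → σ x - (σ x - x)) window)           ≡⟨ sumℤ-map-− σ _ window ⟩
      sumℤ (List.map σ window) - sumℤ (List.map (λ x → σ x - x) window)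
        ≡⟨ cong₂ _-_ values (sumℤ-residues m (λ x → σ x - x) displacement-periodic window window-distinct-mod
                               (ListP.length-applyUpTo _ m)) ⟩
      tri m - sumBelow (λ t → σ (+ t) - + t) m                 ≡⟨ cong (_-_ (tri m)) displacement-sum ⟩
      tri m - + 0                                              ≡⟨ ℤP.+-identityʳ (tri m) ⟩
      tri m                                                    ∎
      where
      open ≡-Reasoning
      sub-sub : ∀ s x → x ≡ s - (s - x)
      sub-sub = solve-∀
      displacement-periodic : ∀ x → σ (x + + m) - (x + + m) ≡ σ x - x
      displacement-periodic x = trans (cong (_- (x + + m)) (periodic x)) (cancel (σ x) x (+ m))
        where
        cancel : ∀ s x M → (s + M) - (x + M) ≡ s - x
        cancel = solve-∀
      values : sumℤ (List.map σ window) ≡ tri m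
      values = begin
        sumℤ (List.map σ window)                    ≡⟨ cong sumℤ (ListP.map-applyUpTo _ σ m) ⟩
        sumℤ (List.applyUpTo (σ ∘ σ⁻¹ ∘ +_ ∘ suc) m) ≡⟨ sumℤ-applyUpTo _ m ⟩
        sumBelow (σ ∘ σ⁻¹ ∘ +_ ∘ suc) m             ≡⟨ sumBelow-cong m (λ t → σ∘σ⁻¹ (+ suc t)) ⟩
        sumBelow (+_ ∘ suc) m                       ≡⟨ sumBelow-suc≡tri m ⟩
        tri m                                       ∎

    fibre : Fin r → List ℤ
    fibre i = preimage (prefix w (toℕ i)) (Vec.lookup w i)

    fibre-complete : ∀ i x → (x ∈ fibre i) ⇔ (F (σ x) ≡ + suc (toℕ i))
    fibre-complete i x = mk⇔ to from
      where
      to : x ∈ fibre i → F (σ x) ≡ + suc (toℕ i)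
      to x∈ with j , j<wᵢ , σx≡ ← ∈-preimage⁻ x∈ =
        trans (cong F σx≡) (trans (fw-window t<m) (cong +_ (block-prefix+ w i j<wᵢ)))
        where
        t<m : prefix w (toℕ i) ℕ.+ j ℕ.< m
        t<m = ℕP.<-≤-trans (ℕP.+-monoʳ-< _ j<wᵢ)
          (subst (ℕ._≤ m) (prefix-suc w i) (subst (_ ℕ.≤_) sum-w (prefix≤sum w (FinP.toℕ<n i))))
      from : F (σ x) ≡ + suc (toℕ i) → x ∈ fibre i
      from Fσx≡
        with t , t<m , σx≡ ← fw-window⁻¹ (σ x) (subst (+ 1 ℤ.≤_) (sym Fσx≡) (+≤+ (s≤s z≤n)))
                                                (subst (ℤ._≤ + r) (sym Fσx≡) (+≤+ (FinP.toℕ<n i)))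
        with i′ , block≡ , j , j<wᵢ , refl ← block-decompose w t (<m⇒<sum t<m)
        with refl ← FinP.toℕ-injective (ℕP.suc-injective (trans (sym block≡)
                      (ℤP.+-injective (trans (sym (fw-window t<m)) (trans (cong F (sym σx≡)) Fσx≡))))) =
        ∈-preimage⁺ j<wᵢ σx≡

    target : InTarget m r n w (F ∘ σ)
    target = composition , weight , λ x → fw-mono (ℤP.<⇒≤ (increasing x))
      where
      composition : IsAffineComposition m r (F ∘ σ)
      composition = record
        { periodic            = λ x → trans (cong F (periodic x)) (fw-periodic (σ x))
        ; window              = window
        ; window-complete     = window-complete
        ; window-unique       = preimage-unique 0 m
        ; window-size         = ListP.length-applyUpTo _ m
        ; window-distinct-mod = window-distinct-mod
        ; window-sum          = window-total
        }
      weight : HasWeight (F ∘ σ) w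
      weight i = fibre i , fibre-complete i , preimage-unique _ _ , ListP.length-applyUpTo _ _

  module Backward (1≤r : 1 ℕ.≤ r) (n : ℕ) (f : ℤ → ℤ) (composition : IsAffineComposition m r f)
                  (weight : HasWeight f w) (stable : IsStable n f) where
    private
      instance
        r≢0 : NonZero r
        r≢0 = ℕ.>-nonZero 1≤r
      module C = IsAffineComposition composition

    fibre : Fin r → List ℤ
    fibre i = proj₁ (weight i)

    ∈-fibre : ∀ i y → (y ∈ fibre i) ⇔ (f y ≡ + suc (toℕ i))
    ∈-fibre i = proj₁ (proj₂ (weight i))

    fibre-unique : ∀ i → Unique (fibre i)
    fibre-unique i = proj₁ (proj₂ (proj₂ (weight i)))

    length-fibre : ∀ i → length (fibre i) ≡ Vec.lookup w i
    length-fibre i = proj₂ (proj₂ (proj₂ (weight i)))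

    f-shift : ∀ x k → f (x + k * + m) ≡ f x + k * + r
    f-shift = shift-multiple f C.periodic

    level : ℤ → ℤ
    level x = (f x - + 1) /ℕ r

    colour : ℤ → Fin r
    colour x = Fin.fromℕ< (n%ℕd<d (f x - + 1) r)

    f-decompose : ∀ x → f x ≡ level x * + r + + suc (toℕ (colour x))
    f-decompose x = begin
      f x                                      ≡⟨ add-one (f x) ⟩
      + 1 + (f x - + 1)                        ≡⟨ cong (_+_ (+ 1)) (a≡a%ℕn+[a/ℕn]*n (f x - + 1) r) ⟩
      + 1 + (+ s + level x * + r)              ≡⟨ regroup (+ s) (level x) (+ r) ⟩
      level x * + r + (+ 1 + + s)              ≡⟨ cong (λ t → level x * + r + + suc t) (sym (FinP.toℕ-fromℕ< _)) ⟩
      level x * + r + + suc (toℕ (colour x))   ∎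
      where
      open ≡-Reasoning
      s : ℕ
      s = (f x - + 1) %ℕ r
      add-one : ∀ x → x ≡ + 1 + (x - + 1)
      add-one = solve-∀
      regroup : ∀ s q R → + 1 + (s + q * R) ≡ q * R + (+ 1 + s)
      regroup = solve-∀

    place : ℤ → Fin r → ℤ → ℤ
    place q i x = + suc (prefix w (toℕ i) ℕ.+ rank (fibre i) (x - q * + m)) + q * + m

    σ : ℤ → ℤ
    σ x = place (level x) (colour x) x

    σ-char : ∀ x q i → f x ≡ q * + r + + suc (toℕ i) → σ x ≡ place q i x
    σ-char x q i fx≡ = cong₂ (λ p j → place p j x) (proj₁ division)
      (FinP.toℕ-injective (trans (FinP.toℕ-fromℕ< _) (proj₂ division)))
      where
      minus-one : ∀ q R s → (q * R + (+ 1 + s)) - + 1 ≡ s + q * R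
      minus-one = solve-∀
      division : (f x - + 1) /ℕ r ≡ q × (f x - + 1) %ℕ r ≡ toℕ i
      division = divMod-unique r q (FinP.toℕ<n i) (trans (cong (_- + 1) fx≡) (minus-one q (+ r) (+ toℕ i)))

    ∈-fibre-unshifted : ∀ x q i → f x ≡ q * + r + + suc (toℕ i) → x - q * + m ∈ fibre i
    ∈-fibre-unshifted x q i fx≡ = Equivalence.from (∈-fibre i _) (begin
      f (x - q * + m)                        ≡⟨ cong f (sub≡add-neg x q (+ m)) ⟩
      f (x + - q * + m)                      ≡⟨ f-shift x (- q) ⟩
      f x + - q * + r                        ≡⟨ cong (_+ - q * + r) fx≡ ⟩
      (q * + r + + suc (toℕ i)) + - q * + r  ≡⟨ cancel q (+ r) _ ⟩
      + suc (toℕ i)                          ∎)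
      where
      open ≡-Reasoning
      sub≡add-neg : ∀ x q M → x - q * M ≡ x + - q * M
      sub≡add-neg = solve-∀
      cancel : ∀ q R s → (q * R + s) + - q * R ≡ s
      cancel = solve-∀

    fw-place : ∀ x q i → f x ≡ q * + r + + suc (toℕ i) → F (place q i x) ≡ f x
    fw-place x q i fx≡ = trans (fw-char t q t<m) (trans (cong (λ b → q * + r + + b) (block-prefix+ w i j<wᵢ)) (sym fx≡))
      where
      j : ℕ
      j = rank (fibre i) (x - q * + m)
      t : ℕ
      t = prefix w (toℕ i) ℕ.+ j
      j<wᵢ : j ℕ.< Vec.lookup w i
      j<wᵢ = subst (j ℕ.<_) (length-fibre i) (rank<length (fibre i) (∈-fibre-unshifted x q i fx≡))
      t<m : t ℕ.< m
      t<m = ℕP.<-≤-trans (ℕP.+-monoʳ-< _ j<wᵢ)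
        (subst (ℕ._≤ m) (prefix-suc w i) (subst (_ ℕ.≤_) sum-w (prefix≤sum w (FinP.toℕ<n i))))

    fw∘σ : ∀ x → F (σ x) ≡ f x
    fw∘σ x = fw-place x (level x) (colour x) (f-decompose x)

    place-< : ∀ q i {x y} → place q i x ℤ.< place q i y ⇔
      rank (fibre i) (x - q * + m) ℕ.< rank (fibre i) (y - q * + m)
    place-< q i = mk⇔
      (λ { lt → ℕP.+-cancelˡ-< (prefix w (toℕ i)) _ _ (ℕP.≤-pred (ℤP.drop‿+<+ (+-cancelʳ-< (q * + m) lt))) })
      (λ { lt → ℤP.+-monoˡ-< (q * + m) (+<+ (s≤s (ℕP.+-monoʳ-< (prefix w (toℕ i)) lt))) })

    σ-<⇔-on-fibres : ∀ x y → f x ≡ f y → σ x ℤ.< σ y ⇔ x ℤ.< y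
    σ-<⇔-on-fibres x y fx≡fy = mk⇔ to from
      where
      q : ℤ
      q = level x
      i : Fin r
      i = colour x
      fy≡ : f y ≡ q * + r + + suc (toℕ i)
      fy≡ = trans (sym fx≡fy) (f-decompose x)
      σy≡ : σ y ≡ place q i y
      σy≡ = σ-char y q i fy≡
      unshift : ∀ x → (x - q * + m) + q * + m ≡ x
      unshift x = cancel x q (+ m)
        where
        cancel : ∀ x q M → (x - q * M) + q * M ≡ x
        cancel = solve-∀
      to : σ x ℤ.< σ y → x ℤ.< y
      to σx<σy = subst₂ ℤ._<_ (unshift x) (unshift y) (ℤP.+-monoˡ-< (q * + m)
        (rank-reflects-< (fibre i) (∈-fibre-unshifted y q i fy≡) (Equivalence.to (place-< q i {x} {y}) (subst (σ x ℤ.<_) σy≡ σx<σy))))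
      from : x ℤ.< y → σ x ℤ.< σ y
      from x<y = subst (σ x ℤ.<_) (sym σy≡) (Equivalence.from (place-< q i {x} {y})
        (rank-< (fibre i) (∈-fibre-unshifted x q i (f-decompose x)) (ℤP.+-monoˡ-< (- (q * + m)) x<y)))

    σ-injective : ∀ x y → σ x ≡ σ y → x ≡ y
    σ-injective x y σx≡σy with ℤP.<-cmp x y
    ... | tri< x<y _ _ = ⊥-elim (ℤP.<-irrefl σx≡σy (Equivalence.from (σ-<⇔-on-fibres x y same-f) x<y))
      where same-f = trans (sym (fw∘σ x)) (trans (cong F σx≡σy) (fw∘σ y))
    ... | tri≈ _ x≡y _ = x≡y
    ... | tri> _ _ y<x = ⊥-elim (ℤP.<-irrefl (sym σx≡σy) (Equivalence.from (σ-<⇔-on-fibres y x same-f) y<x))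
      where same-f = trans (sym (fw∘σ y)) (trans (cong F (sym σx≡σy)) (fw∘σ x))

    σ-periodic : ∀ x → σ (x + + m) ≡ σ x + + m
    σ-periodic x = begin
      σ (x + + m)                                                           ≡⟨ σ-char (x + + m) (q + + 1) i f[x+m]≡ ⟩
      + suc (p ℕ.+ rank (fibre i) ((x + + m) - (q + + 1) * + m)) + (q + + 1) * + m
        ≡⟨ cong (λ y → + suc (p ℕ.+ rank (fibre i) y) + (q + + 1) * + m) (cancel x q (+ m)) ⟩
      + suc (p ℕ.+ rank (fibre i) (x - q * + m)) + (q + + 1) * + m
        ≡⟨ regroup (+ suc (p ℕ.+ rank (fibre i) (x - q * + m))) q (+ m) ⟩
      σ x + + m                                                             ∎
      where
      open ≡-Reasoning
      q : ℤ
      q = level x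
      i : Fin r
      i = colour x
      p : ℕ
      p = prefix w (toℕ i)
      cancel : ∀ x q M → (x + M) - (q + + 1) * M ≡ x - q * M
      cancel = solve-∀
      regroup : ∀ s q M → s + (q + + 1) * M ≡ (s + q * M) + M
      regroup = solve-∀
      regroup′ : ∀ q R s → (q * R + s) + R ≡ (q + + 1) * R + s
      regroup′ = solve-∀
      f[x+m]≡ : f (x + + m) ≡ (q + + 1) * + r + + suc (toℕ i)
      f[x+m]≡ = trans (C.periodic x) (trans (cong (_+ + r) (f-decompose x)) (regroup′ q (+ r) _))

    σ-surjective : ∀ v → ∃ λ x → σ x ≡ v
    σ-surjective v
      with t , q , t<m , refl ← decompose v
      with i , _ , j , j<wᵢ , refl ← block-decompose w t (<m⇒<sum t<m)
      with y , y∈ , rank-y ← rank-surjective (fibre i) (fibre-unique i) j (subst (j ℕ.<_) (sym (length-fibre i)) j<wᵢ) =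
      y + q * + m , (begin
        σ (y + q * + m)                                                     ≡⟨ σ-char _ q i fx≡ ⟩
        + suc (p ℕ.+ rank (fibre i) ((y + q * + m) - q * + m)) + q * + m
          ≡⟨ cong (λ z → + suc (p ℕ.+ rank (fibre i) z) + q * + m) (cancel y q (+ m)) ⟩
        + suc (p ℕ.+ rank (fibre i) y) + q * + m                           ≡⟨ cong (λ k → + suc (p ℕ.+ k) + q * + m) rank-y ⟩
        + suc (p ℕ.+ j) + q * + m                                          ∎)
      where
      open ≡-Reasoning
      p : ℕ
      p = prefix w (toℕ i)
      cancel : ∀ y q M → (y + q * M) - q * M ≡ y
      cancel = solve-∀
      fx≡ : f (y + q * + m) ≡ q * + r + + suc (toℕ i)
      fx≡ = trans (f-shift y q) (trans (cong (_+ q * + r) (Equivalence.to (∈-fibre i y) y∈)) (ℤP.+-comm _ (q * + r)))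

    window-position : ℤ → ℕ
    window-position x = ℕ.pred ∣ σ x ∣

    window-position-spec : ∀ {x} → x ∈ C.window → window-position x ℕ.< m × σ x ≡ + suc (window-position x)
    window-position-spec {x} x∈ with lower , upper ← Equivalence.to (C.window-complete x) x∈
      with t , t<m , σx≡ ← fw-window⁻¹ (σ x) (subst (+ 1 ℤ.≤_) (sym (fw∘σ x)) lower) (subst (ℤ._≤ + r) (sym (fw∘σ x)) upper)
      rewrite σx≡ = t<m , refl

    σ-window-sum : sumTo σ m ≡ tri m
    σ-window-sum = begin
      sumTo σ m                                               ≡⟨ sumTo≡displacement+tri m σ σ-periodic ⟩
      sumBelow (λ t → σ (+ t) - + t) m + tri m                ≡⟨ cong (_+ tri m) displacement-sum ⟩
      + 0 + tri m                                             ≡⟨ ℤP.+-identityˡ (tri m) ⟩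
      tri m                                                   ∎
      where
      open ≡-Reasoning
      values : sumℤ (List.map σ C.window) ≡ tri m
      values = begin
        sumℤ (List.map σ C.window)                                  ≡⟨ sumℤ-map-cong σ _ C.window (proj₂ ∘ window-position-spec) ⟩
        sumℤ (List.map (+_ ∘ suc ∘ window-position) C.window)       ≡⟨ cong sumℤ (ListP.map-∘ C.window) ⟩
        sumℤ (List.map (+_ ∘ suc) (List.map window-position C.window))
          ≡⟨ sumℤ-distinct-below m _
               (Unique-map⁺-on (λ x∈ y∈ e → σ-injective _ _ (trans (proj₂ (window-position-spec x∈))
                                            (trans (cong (+_ ∘ suc) e) (sym (proj₂ (window-position-spec y∈))))))
                               C.window-unique)
               (AllP.map⁺ (All.tabulate (proj₁ ∘ window-position-spec)))
               (trans (ListP.length-map _ C.window) C.window-size) (+_ ∘ suc) ⟩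
        sumBelow (+_ ∘ suc) m                                       ≡⟨ sumBelow-suc≡tri m ⟩
        tri m                                                       ∎
      displacement-periodic : ∀ x → σ (x + + m) - (x + + m) ≡ σ x - x
      displacement-periodic x = trans (cong (_- (x + + m)) (σ-periodic x)) (cancel (σ x) x (+ m))
        where
        cancel : ∀ s x M → (s + M) - (x + M) ≡ s - x
        cancel = solve-∀
      displacement-sum : sumBelow (λ t → σ (+ t) - + t) m ≡ + 0
      displacement-sum = begin
        sumBelow (λ t → σ (+ t) - + t) m
          ≡⟨ sym (sumℤ-residues m _ displacement-periodic C.window C.window-distinct-mod C.window-size) ⟩
        sumℤ (List.map (λ x → σ x - x) C.window)                          ≡⟨ sumℤ-map-− σ id C.window ⟩
        sumℤ (List.map σ C.window) - sumℤ (List.map id C.window)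
          ≡⟨ cong₂ _-_ values (trans (cong sumℤ (ListP.map-id C.window)) C.window-sum) ⟩
        tri m - tri m                                                     ≡⟨ ℤP.+-inverseʳ (tri m) ⟩
        + 0                                                               ∎

    σ-perm : IsAffinePerm m σ
    σ-perm = record
      { injective  = σ-injective
      ; surjective = σ-surjective
      ; periodic   = σ-periodic
      ; window-sum = σ-window-sum
      }

    σ-rep : IsMinCosetRep w σ
    σ-rep i (suc t) 1≤i i≤r (s≤s lower) upper x y σx≡ σy≡ =
      Equivalence.to (σ-<⇔-on-fibres x y same-f) (subst₂ ℤ._<_ (sym σx≡) (sym σy≡) (+<+ ℕP.≤-refl))
      where
      t<prefix : t ℕ.< prefix w i
      t<prefix = ℕP.<-trans (ℕP.n<1+n t) upper
      prefix≤m : prefix w i ℕ.≤ m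
      prefix≤m = subst (_ ℕ.≤_) sum-w (prefix≤sum w i≤r)
      same-block : block w t ≡ block w (suc t)
      same-block = trans (block-unique w i t 1≤i i≤r lower t<prefix)
        (sym (block-unique w i (suc t) 1≤i i≤r (ℕP.m≤n⇒m≤1+n lower) upper))
      same-f : f x ≡ f y
      same-f = begin
        f x                  ≡⟨ sym (fw∘σ x) ⟩
        F (σ x)              ≡⟨ cong F σx≡ ⟩
        F (+ suc t)          ≡⟨ fw-window (ℕP.<-≤-trans t<prefix prefix≤m) ⟩
        + block w t          ≡⟨ cong +_ same-block ⟩
        + block w (suc t)    ≡⟨ sym (fw-window (ℕP.<-≤-trans upper prefix≤m)) ⟩
        F (+ suc (suc t))    ≡⟨ cong F (sym σy≡) ⟩
        F (σ y)              ≡⟨ fw∘σ y ⟩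
        f y                  ∎
        where open ≡-Reasoning

    σ-increasing : 1 ℕ.≤ n → ∀ x → σ x ℤ.< σ (x + ι n)
    σ-increasing (s≤s z≤n) x with ℤP.<-cmp (f x) (f (x + ι n))
    ... | tri< fx<f[x+n] _ _ = fw-reflects-< (subst₂ ℤ._<_ (sym (fw∘σ x)) (sym (fw∘σ (x + ι n))) fx<f[x+n])
    ... | tri≈ _ fx≡f[x+n] _ = Equivalence.from (σ-<⇔-on-fibres x (x + ι n) fx≡f[x+n])
      (subst (ℤ._< x + ι n) (ℤP.+-identityʳ x) (ℤP.+-monoʳ-< x (+<+ (s≤s z≤n))))
    ... | tri> _ _ f[x+n]<fx = ⊥-elim (ℤP.<⇒≱ f[x+n]<fx (stable x))

mainTheorem7 : (m r : ℕ) .{{_ : NonZero m}} → 1 ≤ r →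
    (w : Vec ℕ r) → sum (toList w) ≡ m →
    (n : ℕ) → 1 ≤ n →
    -- maps into the target set
    ((σ : ℤ → ℤ) → InDomain m n w σ → InTarget m r n w (fw m w ∘ σ))
    -- injective on the domain set
    × ((σ τ : ℤ → ℤ) → InDomain m n w σ → InDomain m n w τ →
         (∀ x → fw m w (σ x) ≡ fw m w (τ x)) → ∀ x → σ x ≡ τ x)
    -- surjective onto the target set
    × ((f : ℤ → ℤ) → InTarget m r n w f →
         ∃ λ σ → InDomain m n w σ × (∀ x → fw m w (σ x) ≡ f x))
mainTheorem7 m r 1≤r w sum-w n 1≤n =
    (λ { σ (perm , rep , increasing) → Forward.target n σ perm rep increasing })
  , (λ { σ τ (σ-perm , σ-rep , _) (τ-perm , τ-rep , _) →
         coset-representatives-agree 1≤r σ τ σ-perm σ-rep τ-perm τ-rep })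
  , (λ { f (composition , weight , stable) → let open Backward 1≤r n f composition weight stable in
         σ , (σ-perm , σ-rep , σ-increasing 1≤n) , fw∘σ })
  where open Staircase m w sum-w
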